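{- Let $G$ be a finite simple graph that is $(P_2\cup P_4)$-free and gem-free. Then $\chi(G)\le 3\omega(G)-2$.
   Context: $P_t$ denotes the path on $t$ vertices. For vertex-disjoint graphs $G_1,G_2$, $G_1\cup G_2$ is their disjoint union (no edges between them). A graph $G$ is $H$-free if no induced subgraph of $G$ is isomorphic to $H$. A gem is the graph obtained from a $P_4$ by adding a new vertex adjacent to all four vertices of the $P_4$. $\chi(G)$ is the chromatic number and $\omega(G)$ the clique number of $G$. -}

module Defs where

open import Data.Nat using (ℕ; _≤_)
open import Data.Fin using (Fin; zero; suc)
open import Data.Bool using (Bool; true; false; T)
open import Data.Product using (Σ; _×_; _,_)
open import Data.Empty using (⊥)
open import Relation.Nullary using (¬_; Dec)
open import Relation.Binary.PropositionalEquality using (_≡_)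
open import Function.Definitions using (Injective)
open import Function.Bundles using (_⇔_)

record Graph (n : ℕ) : Set₁ where
  field
    Adj   : Fin n → Fin n → Set
    dec   : ∀ u v → Dec (Adj u v)
    sym   : ∀ {u v} → Adj u v → Adj v u
    irrefl : ∀ {u} → ¬ Adj u u
open Graph public

InducedSubgraph : ∀ {k n} → Graph k → Graph n → Set
InducedSubgraph {k} {n} H G =
  Σ (Fin k → Fin n) λ f →
    Injective _≡_ _≡_ f × (∀ i j → Adj H i j ⇔ Adj G (f i) (f j))

Free : ∀ {k n} → Graph k → Graph n → Set
Free H G = ¬ InducedSubgraph H G

-- Graphs given by a boolean adjacency function (which we check is
-- symmetric and irreflexive on the concrete examples below).
-- P₂ ∪ P₄ on Fin 6: edges 0-1 ; 2-3, 3-4, 4-5.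
p2p4 : Fin 6 → Fin 6 → Bool
p2p4 zero (suc zero) = true
p2p4 (suc zero) zero = true
p2p4 (suc (suc zero)) (suc (suc (suc zero))) = true
p2p4 (suc (suc (suc zero))) (suc (suc zero)) = true
p2p4 (suc (suc (suc zero))) (suc (suc (suc (suc zero)))) = true
p2p4 (suc (suc (suc (suc zero)))) (suc (suc (suc zero))) = true
p2p4 (suc (suc (suc (suc zero)))) (suc (suc (suc (suc (suc zero))))) = true
p2p4 (suc (suc (suc (suc (suc zero))))) (suc (suc (suc (suc zero)))) = true
p2p4 _ _ = false

-- gem on Fin 5: P₄ 0-1-2-3 plus vertex 4 adjacent to 0,1,2,3.
gem : Fin 5 → Fin 5 → Bool
gem zero (suc zero) = true
gem (suc zero) zero = true
gem (suc zero) (suc (suc zero)) = true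
gem (suc (suc zero)) (suc zero) = true
gem (suc (suc zero)) (suc (suc (suc zero))) = true
gem (suc (suc (suc zero))) (suc (suc zero)) = true
gem (suc (suc (suc (suc zero)))) (suc (suc (suc (suc zero)))) = false
gem (suc (suc (suc (suc zero)))) _ = true
gem _ (suc (suc (suc (suc zero)))) = true
gem _ _ = false

open import Data.Bool using (_≟_)
open import Relation.Nullary using (yes; no)

private
  T? : ∀ b → Dec (T b)
  T? true = yes _
  T? false = no λ ()

P2∪P4 : Graph 6
P2∪P4 = record
  { Adj = λ i j → T (p2p4 i j)
  ; dec = λ i j → T? (p2p4 i j)
  ; sym = λ {u} {v} → s u v
  ; irrefl = λ {u} → ir u
  }
  where
  s : ∀ u v → T (p2p4 u v) → T (p2p4 v u)
  s zero (suc zero) t = t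
  s (suc zero) zero t = t
  s (suc (suc zero)) (suc (suc (suc zero))) t = t
  s (suc (suc (suc zero))) (suc (suc zero)) t = t
  s (suc (suc (suc zero))) (suc (suc (suc (suc zero)))) t = t
  s (suc (suc (suc (suc zero)))) (suc (suc (suc zero))) t = t
  s (suc (suc (suc (suc zero)))) (suc (suc (suc (suc (suc zero))))) t = t
  s (suc (suc (suc (suc (suc zero))))) (suc (suc (suc (suc zero)))) t = t
  s zero zero ()
  s zero (suc (suc _)) ()
  s (suc zero) (suc _) ()
  s (suc (suc zero)) zero ()
  s (suc (suc zero)) (suc zero) ()
  s (suc (suc zero)) (suc (suc zero)) ()
  s (suc (suc zero)) (suc (suc (suc (suc _)))) ()
  s (suc (suc (suc zero))) zero ()
  s (suc (suc (suc zero))) (suc zero) ()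
  s (suc (suc (suc zero))) (suc (suc (suc zero))) ()
  s (suc (suc (suc zero))) (suc (suc (suc (suc (suc _))))) ()
  s (suc (suc (suc (suc zero)))) zero ()
  s (suc (suc (suc (suc zero)))) (suc zero) ()
  s (suc (suc (suc (suc zero)))) (suc (suc zero)) ()
  s (suc (suc (suc (suc zero)))) (suc (suc (suc (suc zero)))) ()
  s (suc (suc (suc (suc (suc zero))))) zero ()
  s (suc (suc (suc (suc (suc zero))))) (suc zero) ()
  s (suc (suc (suc (suc (suc zero))))) (suc (suc zero)) ()
  s (suc (suc (suc (suc (suc zero))))) (suc (suc (suc zero))) ()
  s (suc (suc (suc (suc (suc zero))))) (suc (suc (suc (suc (suc _))))) ()
  ir : ∀ u → ¬ T (p2p4 u u)
  ir zero ()
  ir (suc zero) ()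
  ir (suc (suc zero)) ()
  ir (suc (suc (suc zero))) ()
  ir (suc (suc (suc (suc zero)))) ()
  ir (suc (suc (suc (suc (suc zero))))) ()

Gem : Graph 5
Gem = record
  { Adj = λ i j → T (gem i j)
  ; dec = λ i j → T? (gem i j)
  ; sym = λ {u} {v} → s u v
  ; irrefl = λ {u} → ir u
  }
  where
  s : ∀ u v → T (gem u v) → T (gem v u)
  s zero zero ()
  s zero (suc zero) t = t
  s zero (suc (suc zero)) ()
  s zero (suc (suc (suc zero))) ()
  s zero (suc (suc (suc (suc zero)))) t = t
  s (suc zero) zero t = t
  s (suc zero) (suc zero) ()
  s (suc zero) (suc (suc zero)) t = t
  s (suc zero) (suc (suc (suc zero))) ()
  s (suc zero) (suc (suc (suc (suc zero)))) t = t
  s (suc (suc zero)) zero ()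
  s (suc (suc zero)) (suc zero) t = t
  s (suc (suc zero)) (suc (suc zero)) ()
  s (suc (suc zero)) (suc (suc (suc zero))) t = t
  s (suc (suc zero)) (suc (suc (suc (suc zero)))) t = t
  s (suc (suc (suc zero))) zero ()
  s (suc (suc (suc zero))) (suc zero) ()
  s (suc (suc (suc zero))) (suc (suc zero)) t = t
  s (suc (suc (suc zero))) (suc (suc (suc zero))) ()
  s (suc (suc (suc zero))) (suc (suc (suc (suc zero)))) t = t
  s (suc (suc (suc (suc zero)))) zero t = t
  s (suc (suc (suc (suc zero)))) (suc zero) t = t
  s (suc (suc (suc (suc zero)))) (suc (suc zero)) t = t
  s (suc (suc (suc (suc zero)))) (suc (suc (suc zero))) t = t
  s (suc (suc (suc (suc zero)))) (suc (suc (suc (suc zero)))) ()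
  ir : ∀ u → ¬ T (gem u u)
  ir zero ()
  ir (suc zero) ()
  ir (suc (suc zero)) ()
  ir (suc (suc (suc zero))) ()
  ir (suc (suc (suc (suc zero)))) ()

IsClique : ∀ {n k} → Graph n → (Fin k → Fin n) → Set
IsClique G f = Injective _≡_ _≡_ f × (∀ i j → ¬ (i ≡ j) → Adj G (f i) (f j))

IsCliqueNumber : ∀ {n} → Graph n → ℕ → Set
IsCliqueNumber G w =
  Σ (Fin w → Fin _) (IsClique G) × (∀ k (f : Fin k → Fin _) → IsClique G f → k ≤ w)

ProperColouring : ∀ {n} → Graph n → ℕ → Set
ProperColouring {n} G c =
  Σ (Fin n → Fin c) λ col → ∀ u v → Adj G u v → ¬ (col u ≡ col v)

IsChromaticNumber : ∀ {n} → Graph n → ℕ → Set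
IsChromaticNumber G k =
  ProperColouring G k × (∀ c → ProperColouring G c → k ≤ c)

-- Fix an edge uv; every vertex lies in N(u), in N(v), or is adjacent to
-- neither. Gem-freeness makes each neighbourhood P₄-free, and
-- (P₂ ∪ P₄)-freeness makes the common non-neighbourhood of an edge P₄-free.
-- On a P₄-free vertex set a first-fit (Grundy) colouring uses no more colours
-- than the largest clique: a vertex of colour j lies in a clique meeting every
-- colour below j. The neighbourhoods have clique number at most ω − 1, so the
-- three parts need ω − 1, ω − 1 and ω colours. An edgeless graph is P₄-free
-- outright.

module Submission where

open import Defs
open import Data.Bool using (T; true; false)
open import Data.Empty using (⊥-elim)
open import Data.Fin as Fin using (Fin; zero; suc; toℕ; fromℕ<)
open import Data.Fin.Properties using (<-cmp; any?; fromℕ<-injective)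
open import Data.List using ([]; _∷_; length; lookup; filter; allFin)
open import Data.List.Membership.Propositional using (_∈_; _∉_; find; lose)
open import Data.List.Membership.Propositional.Properties using (∈-filter⁺; ∈-filter⁻; ∈-allFin; ∈-lookup)
open import Data.List.Relation.Unary.All as All using (All; []; _∷_)
open import Data.List.Relation.Unary.All.Properties using (¬All⇒Any¬)
open import Data.List.Relation.Unary.AllPairs using (AllPairs; []; _∷_)
open import Data.List.Relation.Unary.Any as Any using (Any; here; there)
open import Data.Nat as ℕ using (ℕ; zero; suc; _≤_; _<_; _+_; _*_; _∸_; _⊔_; _<ᵇ_; s≤s)
open import Data.Nat.Properties
  using (<⇒<ᵇ; <⇒≢; <-irrefl; <-≤-trans; ≤-refl; ≤-reflexive; ≤-trans; n≤1+n; +-comm; +-identityʳ; m≤m⊔n; m≤n⊔m; m≤m+n; m≤n+m; +-monoʳ-<; +-cancelˡ-≡; +-suc; ∸-monoˡ-≤)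
open import Data.Product using (Σ; ∃; ∃₂; _×_; _,_; proj₁; proj₂)
open import Data.Sum using (_⊎_; inj₁; inj₂)
open import Data.Unit using (⊤; tt)
open import Data.Vec.Functional using (updateAt)
open import Data.Vec.Functional.Properties using (updateAt-updates; updateAt-minimal)
open import Function using (_∘_; const)
open import Function.Bundles using (_⇔_; mk⇔; Equivalence)
open import Function.Definitions using (Injective)
open import Relation.Binary.Definitions using (tri<; tri≈; tri>)
open import Relation.Binary.PropositionalEquality as ≡ using (_≡_; _≢_; refl; cong; subst; trans)
open import Relation.Nullary using (¬_; Dec; yes; no; contradiction; ¬?)
open import Relation.Nullary.Decidable using (_×-dec_; decidable-stable)
open import Relation.Unary using (Decidable; _⊆_; _≐_)

pattern 1F = suc zero
pattern 2F = suc 1F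
pattern 3F = suc 2F
pattern 4F = suc 3F
pattern 5F = suc 4F

module _ {n} (G : Graph n) where

  separated⇒≢ : ∀ {x y z} → Adj G z x → ¬ Adj G z y → x ≢ y
  separated⇒≢ zx ¬zy refl = ¬zy zx

  adj⇒≢ : ∀ {x y} → Adj G x y → x ≢ y
  adj⇒≢ xy refl = irrefl G xy

  edge? : Dec (∃₂ λ u v → Adj G u v)
  edge? = any? λ u → any? λ v → dec G u v

module _ {k n} (H : Graph k) (G : Graph n) (f : Fin k → Fin n) where

  -- Stated with the boolean order so that, for concrete H, the pairs i ≥ j are
  -- refuted by evaluation and the tables below need no absurd clauses.
  inducedSubgraph-from-< :
    (∀ i j → T (toℕ i <ᵇ toℕ j) → f i ≢ f j × (Adj H i j ⇔ Adj G (f i) (f j))) →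
    InducedSubgraph H G
  inducedSubgraph-from-< upper = f , injective , agree
    where
    upper< : ∀ {i j} → i Fin.< j → f i ≢ f j × (Adj H i j ⇔ Adj G (f i) (f j))
    upper< {i} {j} i<j = upper i j (<⇒<ᵇ i<j)

    injective : Injective _≡_ _≡_ f
    injective {i} {j} fi≡fj with <-cmp i j
    ... | tri< i<j _ _ = contradiction fi≡fj (proj₁ (upper< i<j))
    ... | tri≈ _ i≡j _ = i≡j
    ... | tri> _ _ j<i = contradiction (≡.sym fi≡fj) (proj₁ (upper< j<i))

    agree : ∀ i j → Adj H i j ⇔ Adj G (f i) (f j)
    agree i j with <-cmp i j
    ... | tri< i<j _ _ = proj₂ (upper< i<j)
    ... | tri≈ _ refl _ = mk⇔ (⊥-elim ∘ irrefl H) (⊥-elim ∘ irrefl G)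
    ... | tri> _ _ j<i = mk⇔ (sym G ∘ to ∘ sym H) (sym H ∘ from ∘ sym G)
      where open Equivalence (proj₂ (upper< j<i))

module _ {n} (G : Graph n) {x y : Fin n} where

  edge : Adj G x y → x ≢ y × (T true ⇔ Adj G x y)
  edge xy = adj⇒≢ G xy , mk⇔ (const xy) (const tt)

  non-edge : x ≢ y → ¬ Adj G x y → x ≢ y × (T false ⇔ Adj G x y)
  non-edge x≢y ¬xy = x≢y , mk⇔ (λ ()) (⊥-elim ∘ ¬xy)

record InducedP₄ {n} (G : Graph n) (a b c d : Fin n) : Set where
  field
    ab : Adj G a b
    bc : Adj G b c
    cd : Adj G c d
    ¬ac : ¬ Adj G a c
    ¬bd : ¬ Adj G b d
    ¬ad : ¬ Adj G a d

  a≢c : a ≢ c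
  a≢c refl = ¬ad cd

  b≢d : b ≢ d
  b≢d refl = ¬ad ab

  a≢d : a ≢ d
  a≢d refl = ¬ac (sym G cd)

P₄FreeOn : ∀ {n} → Graph n → (Fin n → Set) → Set
P₄FreeOn G P = ∀ {a b c d} → P a → P b → P c → P d → ¬ InducedP₄ G a b c d

module _ {n} (G : Graph n) where

  gem-free⇒neighbourhood-P₄-free : Free Gem G → ∀ h → P₄FreeOn G (Adj G h)
  gem-free⇒neighbourhood-P₄-free gem-free h {a} {b} {c} {d} ha hb hc hd p₄ =
    gem-free (inducedSubgraph-from-< Gem G vertex pairs)
    where
    open InducedP₄ p₄

    vertex : Fin 5 → Fin n
    vertex zero = a
    vertex 1F = b
    vertex 2F = c
    vertex 3F = d
    vertex 4F = h

    pairs : ∀ i j → T (toℕ i <ᵇ toℕ j) →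
      vertex i ≢ vertex j × (Adj Gem i j ⇔ Adj G (vertex i) (vertex j))
    pairs zero 1F _ = edge G ab
    pairs zero 2F _ = non-edge G a≢c ¬ac
    pairs zero 3F _ = non-edge G a≢d ¬ad
    pairs zero 4F _ = edge G (sym G ha)
    pairs 1F 2F _ = edge G bc
    pairs 1F 3F _ = non-edge G b≢d ¬bd
    pairs 1F 4F _ = edge G (sym G hb)
    pairs 2F 3F _ = edge G cd
    pairs 2F 4F _ = edge G (sym G hc)
    pairs 3F 4F _ = edge G (sym G hd)

  P₂∪P₄-free⇒non-neighbourhood-P₄-free : Free P2∪P4 G → ∀ {u v} → Adj G u v →
    P₄FreeOn G (λ x → ¬ Adj G u x × ¬ Adj G v x)
  P₂∪P₄-free⇒non-neighbourhood-P₄-free p₂∪p₄-free {u} {v} uv {a} {b} {c} {d}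
    (¬ua , ¬va) (¬ub , ¬vb) (¬uc , ¬vc) (¬ud , ¬vd) p₄ =
    p₂∪p₄-free (inducedSubgraph-from-< P2∪P4 G vertex pairs)
    where
    open InducedP₄ p₄

    u≢ : ∀ {x} → ¬ Adj G v x → u ≢ x
    u≢ = separated⇒≢ G (sym G uv)

    v≢ : ∀ {x} → ¬ Adj G u x → v ≢ x
    v≢ = separated⇒≢ G uv

    vertex : Fin 6 → Fin n
    vertex zero = u
    vertex 1F = v
    vertex 2F = a
    vertex 3F = b
    vertex 4F = c
    vertex 5F = d

    pairs : ∀ i j → T (toℕ i <ᵇ toℕ j) →
      vertex i ≢ vertex j × (Adj P2∪P4 i j ⇔ Adj G (vertex i) (vertex j))
    pairs zero 1F _ = edge G uv
    pairs zero 2F _ = non-edge G (u≢ ¬va) ¬ua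
    pairs zero 3F _ = non-edge G (u≢ ¬vb) ¬ub
    pairs zero 4F _ = non-edge G (u≢ ¬vc) ¬uc
    pairs zero 5F _ = non-edge G (u≢ ¬vd) ¬ud
    pairs 1F 2F _ = non-edge G (v≢ ¬ua) ¬va
    pairs 1F 3F _ = non-edge G (v≢ ¬ub) ¬vb
    pairs 1F 4F _ = non-edge G (v≢ ¬uc) ¬vc
    pairs 1F 5F _ = non-edge G (v≢ ¬ud) ¬vd
    pairs 2F 3F _ = edge G ab
    pairs 2F 4F _ = non-edge G a≢c ¬ac
    pairs 2F 5F _ = non-edge G a≢d ¬ad
    pairs 3F 4F _ = edge G bc
    pairs 3F 5F _ = non-edge G b≢d ¬bd
    pairs 4F 5F _ = edge G cd

module _ {a r} {A : Set a} {R : A → A → Set r} (R-sym : ∀ {x y} → R x y → R y x) where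

  allPairs-lookup : ∀ {xs} → AllPairs R xs → ∀ i j → i ≢ j → R (lookup xs i) (lookup xs j)
  allPairs-lookup (_ ∷ _) zero zero i≢j = contradiction refl i≢j
  allPairs-lookup (rx ∷ _) zero (suc j) _ = All.lookup rx (∈-lookup j)
  allPairs-lookup (rx ∷ _) (suc i) zero _ = R-sym (All.lookup rx (∈-lookup i))
  allPairs-lookup (_ ∷ rxs) (suc i) (suc j) i≢j = allPairs-lookup rxs i j (i≢j ∘ cong suc)

module _ {n} (G : Graph n) where

  clique-length≤ : ∀ {w} → IsCliqueNumber G w → ∀ {K} → AllPairs (Adj G) K → length K ≤ w
  clique-length≤ (_ , maximum) {K} clique =
    maximum (length K) (lookup K) (injective , allPairs-lookup (sym G) clique)
    where
    injective : Injective _≡_ _≡_ (lookup K)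
    injective {i} {j} Ki≡Kj with i Fin.≟ j
    ... | yes i≡j = i≡j
    ... | no i≢j = contradiction Ki≡Kj (adj⇒≢ G (allPairs-lookup (sym G) clique i j i≢j))

  ProperOn : (Fin n → Set) → (Fin n → ℕ) → Set
  ProperOn P f = ∀ {x y} → P x → P y → Adj G x y → f x ≢ f y

  GrundyOn : (Fin n → Set) → (Fin n → ℕ) → Set
  GrundyOn P f = ∀ {x} → P x → ∀ {j} → j < f x → ∃ λ y → P y × Adj G x y × f y ≡ j

  ColouringOn : (Fin n → Set) → ℕ → Set
  ColouringOn P k = Σ (Fin n → ℕ) λ f → ProperOn P f × (∀ {x} → P x → f x < k)

  ProperOn-⊆ : ∀ {P Q f} → Q ⊆ P → ProperOn P f → ProperOn Q f
  ProperOn-⊆ Q⊆P proper qx qy = proper (Q⊆P qx) (Q⊆P qy)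

  GrundyOn-≐ : ∀ {P Q f} → P ≐ Q → GrundyOn P f → GrundyOn Q f
  GrundyOn-≐ (P⊆Q , Q⊆P) grundy qx j<fx =
    let y , py , xy , fy≡j = grundy (Q⊆P qx) j<fx in y , P⊆Q py , xy , fy≡j

  ColouringOn⇒ProperColouring : ∀ {P k} → (∀ x → P x) → ColouringOn P k → ProperColouring G k
  ColouringOn⇒ProperColouring everywhere (f , proper , f<k) =
    (λ x → fromℕ< (f<k (everywhere x))) ,
    λ x y xy e → proper (everywhere x) (everywhere y) xy (fromℕ<-injective _ _ _ _ e)

least-witness : {P : ℕ → Set} → Decidable P → ∀ {N} → P N →
  ∃ λ m → P m × (∀ {j} → j < m → ¬ P j)
least-witness P? {zero} p₀ = zero , p₀ , λ ()
least-witness P? {suc N} pN with P? zero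
... | yes p₀ = zero , p₀ , λ ()
... | no ¬p₀ with least-witness (P? ∘ suc) pN
...   | m , pm , below = suc m , pm , λ { {zero} _ → ¬p₀ ; {suc j} (s≤s j<m) → below j<m }

strict-upper-bound : ∀ {a} {A : Set a} (f : A → ℕ) xs → ∃ λ N → All (λ y → f y < N) xs
strict-upper-bound f [] = 0 , []
strict-upper-bound f (x ∷ xs) =
  let N , below = strict-upper-bound f xs
  in suc (f x) ⊔ N , m≤m⊔n (suc (f x)) N ∷ All.map (λ fy<N → <-≤-trans fy<N (m≤n⊔m _ N)) below

module _ {n} (G : Graph n) where

  first-fit-step : ∀ {v xs f} → v ∉ xs → ProperOn G (_∈ xs) f → GrundyOn G (_∈ xs) f →
    ∃ λ f′ → ProperOn G (_∈ v ∷ xs) f′ × GrundyOn G (_∈ v ∷ xs) f′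
  first-fit-step {v} {xs} {f} v∉xs proper grundy = f′ , proper′ , grundy′
    where
    Seen : ℕ → Set
    Seen j = Any (λ y → Adj G v y × f y ≡ j) xs

    seen? : Decidable Seen
    seen? j = Any.any? (λ y → dec G v y ×-dec f y ℕ.≟ j) xs

    unseen : ∃ λ N → ¬ Seen N
    unseen with strict-upper-bound f xs
    ... | N , below = N , λ s → let y , y∈xs , _ , fy≡N = find s in <-irrefl fy≡N (All.lookup below y∈xs)

    first-unseen : ∃ λ m → ¬ Seen m × (∀ {j} → j < m → ¬ ¬ Seen j)
    first-unseen = least-witness (¬? ∘ seen?) (proj₂ unseen)

    m : ℕ
    m = proj₁ first-unseen

    unseen-m : ¬ Seen m
    unseen-m = proj₁ (proj₂ first-unseen)

    seen-below : ∀ {j} → j < m → Seen j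
    seen-below {j} j<m = decidable-stable (seen? j) (proj₂ (proj₂ first-unseen) j<m)

    f′ : Fin n → ℕ
    f′ = updateAt f v (const m)

    f′-new : f′ v ≡ m
    f′-new = updateAt-updates v f

    f′-old : ∀ {y} → y ∈ xs → f′ y ≡ f y
    f′-old {y} y∈xs = updateAt-minimal y v f λ { refl → v∉xs y∈xs }

    proper′ : ProperOn G (_∈ v ∷ xs) f′
    proper′ (here refl) (here refl) vv = contradiction vv (irrefl G)
    proper′ (here refl) (there y∈xs) vy f′v≡f′y =
      unseen-m (lose y∈xs (vy , trans (≡.sym (f′-old y∈xs)) (trans (≡.sym f′v≡f′y) f′-new)))
    proper′ (there x∈xs) (here refl) xv f′x≡f′v =
      proper′ (here refl) (there x∈xs) (sym G xv) (≡.sym f′x≡f′v)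
    proper′ (there x∈xs) (there y∈xs) xy f′x≡f′y =
      proper x∈xs y∈xs xy (trans (≡.sym (f′-old x∈xs)) (trans f′x≡f′y (f′-old y∈xs)))

    grundy′ : GrundyOn G (_∈ v ∷ xs) f′
    grundy′ (here refl) j<f′v with find (seen-below (subst (_ <_) f′-new j<f′v))
    ... | y , y∈xs , vy , fy≡j = y , there y∈xs , vy , trans (f′-old y∈xs) fy≡j
    grundy′ (there x∈xs) j<f′x with grundy x∈xs (subst (_ <_) (f′-old x∈xs) j<f′x)
    ... | y , y∈xs , xy , fy≡j = y , there y∈xs , xy , trans (f′-old y∈xs) fy≡j

  first-fit : ∀ xs → ∃ λ f → ProperOn G (_∈ xs) f × GrundyOn G (_∈ xs) f
  first-fit [] = const 0 , (λ ()) , (λ ())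
  first-fit (v ∷ xs) with first-fit xs | Any.any? (v Fin.≟_) xs
  ... | f , proper , grundy | no v∉xs = first-fit-step v∉xs proper grundy
  ... | f , proper , grundy | yes v∈xs =
    f , ProperOn-⊆ G shrink proper , GrundyOn-≐ G (there , shrink) grundy
    where
    shrink : (_∈ v ∷ xs) ⊆ (_∈ xs)
    shrink (here refl) = v∈xs
    shrink (there x∈xs) = x∈xs

  grundy-colouring : ∀ {P} → Decidable P → ∃ λ f → ProperOn G P f × GrundyOn G P f
  grundy-colouring {P} P? with first-fit (filter P? (allFin n))
  ... | f , proper , grundy = f , ProperOn-⊆ G listed proper , GrundyOn-≐ G (unlisted , listed) grundy
    where
    listed : P ⊆ (_∈ filter P? (allFin n))
    listed {x} = ∈-filter⁺ P? (∈-allFin x)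

    unlisted : (_∈ filter P? (allFin n)) ⊆ P
    unlisted = proj₂ ∘ ∈-filter⁻ P? {xs = allFin n}

module _ {n} (G : Graph n) {P : Fin n → Set} {f : Fin n → ℕ}
         (P₄-free : P₄FreeOn G P) (proper : ProperOn G P f) (grundy : GrundyOn G P f) where

  -- If neither the neighbour w of K nor the neighbour w′ of z works, then
  -- w – z′ – z – w′ is an induced P₄ for a vertex z′ ∈ K missed by w′.
  common-neighbour-of-colour : ∀ {j} z K → All P (z ∷ K) → All (λ y → j < f y) (z ∷ K) →
    AllPairs (Adj G) (z ∷ K) → ∃ λ w → P w × f w ≡ j × All (Adj G w) (z ∷ K)
  common-neighbour-of-colour z [] (pz ∷ []) (j<fz ∷ []) _ with grundy pz j<fz
  ... | w , pw , zw , fw≡j = w , pw , fw≡j , sym G zw ∷ []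
  common-neighbour-of-colour z (z₁ ∷ K) (pz ∷ pK) (j<fz ∷ j<fK) (zK ∷ clique)
    with common-neighbour-of-colour z₁ K pK j<fK clique
  ... | w , pw , fw≡j , wK with dec G w z
  ...   | yes wz = w , pw , fw≡j , wz ∷ wK
  ...   | no ¬wz with grundy pz j<fz
  ...     | w′ , pw′ , zw′ , fw′≡j with All.all? (dec G w′) (z₁ ∷ K)
  ...       | yes w′K = w′ , pw′ , fw′≡j , sym G zw′ ∷ w′K
  ...       | no ¬w′K with find (¬All⇒Any¬ (dec G w′) _ ¬w′K)
  ...         | z′ , z′∈K , ¬w′z′ = contradiction path (P₄-free pw (All.lookup pK z′∈K) pz pw′)
    where
    path : InducedP₄ G w z′ z w′
    path = record
      { ab = All.lookup wK z′∈K
      ; bc = sym G (All.lookup zK z′∈K)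
      ; cd = zw′
      ; ¬ac = ¬wz
      ; ¬bd = ¬w′z′ ∘ sym G
      ; ¬ad = λ ww′ → proper pw pw′ ww′ (trans fw≡j (≡.sym fw′≡j))
      }

  clique-extension : ∀ j z K → All P (z ∷ K) → All (λ y → j ≤ f y) (z ∷ K) →
    AllPairs (Adj G) (z ∷ K) →
    ∃ λ K′ → All P K′ × AllPairs (Adj G) K′ × length K′ ≡ j + length (z ∷ K)
  clique-extension zero z K pK _ clique = z ∷ K , pK , clique , refl
  clique-extension (suc j) z K pK j<fK clique
    with common-neighbour-of-colour z K pK j<fK clique
  ... | w , pw , fw≡j , wK
    with clique-extension j w (z ∷ K) (pw ∷ pK)
           (≤-reflexive (≡.sym fw≡j) ∷ All.map (≤-trans (n≤1+n j)) j<fK) (wK ∷ clique)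
  ... | K′ , pK′ , clique′ , length≡ = K′ , pK′ , clique′ , trans length≡ (+-suc j _)

  colour<clique : ∀ {x} → P x → ∃ λ K → All P K × AllPairs (Adj G) K × suc (f x) ≤ length K
  colour<clique {x} px with clique-extension (f x) x [] (px ∷ []) (≤-refl ∷ []) ([] ∷ [])
  ... | K , pK , clique , length≡ = K , pK , clique , ≤-reflexive (≡.sym (trans length≡ (+-comm (f x) 1)))

module _ {n} (G : Graph n) where

  P₄-free⇒colourable : ∀ {P} → Decidable P → P₄FreeOn G P → ∀ {k} →
    (∀ {K} → All P K → AllPairs (Adj G) K → length K ≤ k) → ColouringOn G P k
  P₄-free⇒colourable {P} P? P₄-free {k} cliques-bounded with grundy-colouring G P?
  ... | f , proper , grundy = f , proper , colour<k
    where
    colour<k : ∀ {x} → P x → f x < k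
    colour<k px =
      let K , pK , clique , fx<|K| = colour<clique G P₄-free proper grundy px
      in ≤-trans fx<|K| (cliques-bounded pK clique)

  colouringOn-⊎ : ∀ {P Q a b} → Decidable P → ColouringOn G P a → ColouringOn G Q b →
    ColouringOn G (λ x → P x ⊎ Q x) (a + b)
  colouringOn-⊎ {P} {Q} {a} {b} P? (f , proper-f , f<a) (g , proper-g , g<b) = h , proper-h , h<a+b
    where
    h : Fin n → ℕ
    h x with P? x
    ... | yes _ = f x
    ... | no _ = a + g x

    Side : Fin n → Set
    Side x = (P x × h x ≡ f x) ⊎ (Q x × h x ≡ a + g x)

    side : ∀ {x} → P x ⊎ Q x → Side x
    side {x} pq with P? x | pq
    ... | yes px | _ = inj₁ (px , refl)
    ... | no ¬px | inj₁ px = contradiction px ¬px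
    ... | no _ | inj₂ qx = inj₂ (qx , refl)

    low≢high : ∀ {i} → i < a → ∀ j → i ≢ a + j
    low≢high i<a j = <⇒≢ (<-≤-trans i<a (m≤m+n a j))

    proper-sides : ∀ {x y} → Side x → Side y → Adj G x y → h x ≢ h y
    proper-sides (inj₁ (px , hx)) (inj₁ (py , hy)) xy rewrite hx | hy = proper-f px py xy
    proper-sides (inj₂ (qx , hx)) (inj₂ (qy , hy)) xy rewrite hx | hy =
      proper-g qx qy xy ∘ +-cancelˡ-≡ a _ _
    proper-sides (inj₁ (px , hx)) (inj₂ (_ , hy)) _ rewrite hx | hy = low≢high (f<a px) _
    proper-sides (inj₂ (_ , hx)) (inj₁ (py , hy)) _ rewrite hx | hy = low≢high (f<a py) _ ∘ ≡.sym

    proper-h : ProperOn G (λ x → P x ⊎ Q x) h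
    proper-h x∈ y∈ = proper-sides (side x∈) (side y∈)

    h<a+b : ∀ {x} → P x ⊎ Q x → h x < a + b
    h<a+b x∈ with side x∈
    ... | inj₁ (px , hx) rewrite hx = <-≤-trans (f<a px) (m≤m+n a b)
    ... | inj₂ (qx , hx) rewrite hx = +-monoʳ-< a (g<b qx)

  module _ {w} (ω≡w : IsCliqueNumber G w) where

    neighbourhood-colouring : Free Gem G → ∀ h → ColouringOn G (Adj G h) (w ∸ 1)
    neighbourhood-colouring gem-free h =
      P₄-free⇒colourable (dec G h) (gem-free⇒neighbourhood-P₄-free G gem-free h)
        λ hK clique → ∸-monoˡ-≤ 1 (clique-length≤ G ω≡w (hK ∷ clique))

    non-neighbourhood-colouring : Free P2∪P4 G → ∀ {u v} → Adj G u v →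
      ColouringOn G (λ x → ¬ Adj G u x × ¬ Adj G v x) w
    non-neighbourhood-colouring p₂∪p₄-free {u} {v} uv =
      P₄-free⇒colourable (λ x → ¬? (dec G u x) ×-dec ¬? (dec G v x))
        (P₂∪P₄-free⇒non-neighbourhood-P₄-free G p₂∪p₄-free uv)
        λ _ → clique-length≤ G ω≡w

    edgeless-colouring : ¬ (∃₂ λ u v → Adj G u v) → ColouringOn G (const ⊤) w
    edgeless-colouring edgeless =
      P₄-free⇒colourable (λ _ → yes tt) (λ {a} {b} _ _ _ _ p₄ → edgeless (a , b , InducedP₄.ab p₄))
        λ _ → clique-length≤ G ω≡w

3*w∸2≡w∸1+[w∸1+w] : ∀ w → 3 * w ∸ 2 ≡ w ∸ 1 + (w ∸ 1 + w)
3*w∸2≡w∸1+[w∸1+w] zero = refl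
3*w∸2≡w∸1+[w∸1+w] (suc w) = begin
  w + suc (w + (suc w + 0)) ∸ 1   ≡⟨ cong (_∸ 1) (+-suc w (w + (suc w + 0))) ⟩
  w + (w + (suc w + 0))           ≡⟨ cong (λ t → w + (w + t)) (+-identityʳ (suc w)) ⟩
  w + (w + suc w)                 ∎
  where open ≡.≡-Reasoning

w≤3*w∸2 : ∀ w → w ≤ 3 * w ∸ 2
w≤3*w∸2 w rewrite 3*w∸2≡w∸1+[w∸1+w] w = ≤-trans (m≤n+m w (w ∸ 1)) (m≤n+m _ (w ∸ 1))

theorem1p1 : ∀ {n} (G : Graph n) → Free P2∪P4 G → Free Gem G →
    ∀ w χ → IsCliqueNumber G w → IsChromaticNumber G χ → χ ≤ 3 * w ∸ 2
theorem1p1 G p₂∪p₄-free gem-free w χ ω≡w (_ , χ-minimal) with edge? G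
... | no edgeless =
  ≤-trans (χ-minimal w (ColouringOn⇒ProperColouring G (const tt) (edgeless-colouring G ω≡w edgeless)))
          (w≤3*w∸2 w)
... | yes (u , v , uv) rewrite 3*w∸2≡w∸1+[w∸1+w] w =
  χ-minimal _ (ColouringOn⇒ProperColouring G classify
    (colouringOn-⊎ G (dec G u) (neighbourhood-colouring G ω≡w gem-free u)
      (colouringOn-⊎ G (dec G v) (neighbourhood-colouring G ω≡w gem-free v)
        (non-neighbourhood-colouring G ω≡w p₂∪p₄-free uv))))
  where
  classify : ∀ x → Adj G u x ⊎ (Adj G v x ⊎ (¬ Adj G u x × ¬ Adj G v x))
  classify x with dec G u x | dec G v x
  ... | yes ux | _ = inj₁ ux
  ... | no _ | yes vx = inj₂ (inj₁ vx)
  ... | no ¬ux | no ¬vx = inj₂ (inj₂ (¬ux , ¬vx))
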